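{- Let $p\ge 3$ be a fixed prime, $X\ge1$ real, and $a,b\ge1$ integers with $1\le a\le 2b$. Then \[ I_1(X;a,b)\le p^{2b-a} I_1(X;2b,b). \]
   Context: Write $e(t)=e^{2\pi i t}$. For $\boldsymbol\alpha=(\alpha_1,\alpha_2)\in(0,1]^2$, an integer $\xi$ and an integer $a\ge1$, set $f_a(\boldsymbol\alpha;\xi)=\sum_{1\le x\le X,\ x\equiv \xi \ (\mathrm{mod}\ p^a)} e(\alpha_1x+\alpha_2x^2)$. For integers $\xi,\eta$ and $a,b\ge1$ define $I_1(X;\xi,\eta;a,b)=\int_{(0,1]^2}|f_a(\boldsymbol\alpha;\xi)|^{2}|f_b(\boldsymbol\alpha;\eta)|^{4}\,d\boldsymbol\alpha$ (equivalently, the number of integer solutions $1\le x_i\le X$ of $x_1^j+x_2^j+x_3^j=x_4^j+x_5^j+x_6^j$, $j=1,2$, with $x_1\equiv x_4\equiv\xi \bmod p^a$ and $x_2,x_3,x_5,x_6\equiv \eta \bmod p^b$), and $I_1(X;a,b)=\max I_1(X;\xi,\eta;a,b)$, the maximum over integers $\xi,\eta$ with $\xi\not\equiv\eta \ (\mathrm{mod}\ p)$. -}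

module Defs where

open import Data.Nat using (ℕ; zero; suc; _+_; _*_; _^_; _⊔_; _≡ᵇ_)
open import Data.Nat.DivMod using (_%_)
open import Data.Bool using (Bool; true; false; _∧_; not; if_then_else_)
open import Data.List using (List; []; _∷_; map; upTo; foldr; concatMap)
open import Data.Nat.ListAction using (sum)
open import Function using (_∘_)

-- residue of x modulo m (m = 0 never occurs below, since p^a ≥ 1)
_mod_ : ℕ → ℕ → ℕ
x mod zero = x
x mod suc m = x % suc m

cong? : ℕ → ℕ → ℕ → Bool
cong? m x y = (x mod m) ≡ᵇ (y mod m)

range : ℕ → List ℕ
range X = map suc (upTo X)

Σ≤ : ℕ → (ℕ → ℕ) → ℕ
Σ≤ X f = sum (map f (range X))

𝟙 : Bool → ℕ
𝟙 b = if b then 1 else 0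

I₁at : (X p : ℕ) → (ξ η a b : ℕ) → ℕ
I₁at X p ξ η a b =
  Σ≤ X λ x₁ → Σ≤ X λ x₂ → Σ≤ X λ x₃ → Σ≤ X λ x₄ → Σ≤ X λ x₅ → Σ≤ X λ x₆ →
    𝟙 ( ((x₁ + x₂ + x₃) ≡ᵇ (x₄ + x₅ + x₆))
      ∧ ((x₁ * x₁ + x₂ * x₂ + x₃ * x₃) ≡ᵇ (x₄ * x₄ + x₅ * x₅ + x₆ * x₆))
      ∧ cong? (p ^ a) x₁ ξ ∧ cong? (p ^ a) x₄ ξ
      ∧ cong? (p ^ b) x₂ η ∧ cong? (p ^ b) x₃ η
      ∧ cong? (p ^ b) x₅ η ∧ cong? (p ^ b) x₆ η )

maxList : List ℕ → ℕ
maxList = foldr _⊔_ 0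

-- Since I₁(X;ξ,η;a,b) depends
-- only on ξ mod p^a and η mod p^b, the max ranges over representatives
-- 0 ≤ ξ < p^a, 0 ≤ η < p^b (and ξ ≢ η mod p is a condition on those residues,
-- as p ∣ p^a and p ∣ p^b for a, b ≥ 1).
I₁ : (X p a b : ℕ) → ℕ
I₁ X p a b =
  maxList (concatMap (λ ξ → concatMap (λ η →
      if cong? p ξ η then [] else (I₁at X p ξ η a b ∷ []))
    (upTo (p ^ b))) (upTo (p ^ a)))

{-# OPTIONS --safe #-}
module Submission where

-- Let x₁ ≡ x₄ ≡ ξ (mod pᵃ) and x₂, x₃, x₅, x₆ ≡ η (mod pᵇ) solve the system. Eliminating with
-- the two equations gives (x₁ − x₄)(x₁ + x₄ − 2x₂) = (x₅ − x₂)² + (x₆ − x₃)(x₆ − x₃ + 2(x₃ − x₂)),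
-- which is divisible by p²ᵇ, while x₁ + x₄ − 2x₂ ≡ 2(ξ − η) is a unit mod p because p is odd and
-- ξ ≢ η (mod p). Hence x₁ ≡ x₄ (mod p²ᵇ), so each solution counted by I₁(X; ξ, η; a, b) is counted
-- by I₁(X; ξ′, η; 2b, b) for one of the p^(2b−a) lifts ξ′ = ξ + k pᵃ of ξ to a residue mod p²ᵇ,
-- and every such pair (ξ′, η) is again admissible in the maximum defining I₁(X; 2b, b).

-- These two modules carry their own imports and precede the top-level ones, whose ℕ operators
-- would clash with the ℤ operators used here.
module PrimePowers where
  open import Data.Nat.Base using (ℕ; zero; suc; _*_; _^_)
  open import Data.Nat.Properties using (*-comm; *-assoc)
  open import Data.Nat.Divisibility using (_∣_; divides; ∣-trans; 1∣_; m∣m*n; *-monoʳ-∣; *-cancelˡ-∣)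
  open import Data.Nat.Primality using (Prime; euclidsLemma; prime⇒nonZero)
  open import Data.Sum using (inj₁; inj₂)
  open import Relation.Nullary using (¬_; contradiction)
  open import Relation.Binary.PropositionalEquality using (_≡_; refl; cong; trans; subst)

  p^k∣m*n⇒p^k∣m : ∀ {p n} → Prime p → ¬ p ∣ n → ∀ k {m} → p ^ k ∣ m * n → p ^ k ∣ m
  p^k∣m*n⇒p^k∣m p-prime p∤n zero p^0∣mn = 1∣ _
  p^k∣m*n⇒p^k∣m {p} {n} p-prime p∤n (suc k) {m} p^[1+k]∣mn
    with euclidsLemma m n p-prime (∣-trans (m∣m*n (p ^ k)) p^[1+k]∣mn)
  ... | inj₂ p∣n = contradiction p∣n p∤n
  ... | inj₁ (divides q refl) = subst (p ^ suc k ∣_) (*-comm p q)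
    (*-monoʳ-∣ p (p^k∣m*n⇒p^k∣m p-prime p∤n k
      (*-cancelˡ-∣ p {{prime⇒nonZero p-prime}} (subst (p ^ suc k ∣_) regroup p^[1+k]∣mn))))
    where
    regroup : q * p * n ≡ p * (q * n)
    regroup = trans (cong (_* n) (*-comm q p)) (*-assoc p q n)

module IntegerCongruences where
  open import Data.Integer.Base using (ℤ; +_; _+_; _-_; _*_; 0ℤ; ∣_∣; _⊖_)
  open import Data.Integer.Properties
    using (pos-+; pos-*; i≡j⇒i-j≡0; m-n≡m⊖n; ∣m⊖n∣≡∣n⊖m∣; ∣⊖∣-≤; abs-*)
  open import Data.Integer.Divisibility.Signed
  open import Data.Integer.Tactic.RingSolver using (solve-∀)
  open import Data.Nat.Base as ℕ using (ℕ; NonZero; s≤s; z≤n)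
  open import Data.Nat.DivMod using (_%_; _/_; m≡m%n+[m/n]*n; %-remove-+ʳ)
  import Data.Nat.Divisibility as ℕ
  open import Data.Nat.Primality using (Prime; euclidsLemma)
  open import Data.Nat.Properties using (≤-total; ≤-trans; <⇒≱; m+[n∸m]≡n; ^-distribˡ-+-*; +-identityʳ)
  open import Data.Sum using (inj₁; inj₂)
  open import Function using (_∘_)
  open import Relation.Nullary using (¬_)
  open import Relation.Binary.PropositionalEquality
  open ≡-Reasoning
  open PrimePowers

  *-pres-∣ : ∀ {i j m n} → i ∣ m → j ∣ n → i * j ∣ m * n
  *-pres-∣ {j = j} {m} i∣m j∣n = ∣-trans (*-monoˡ-∣ j i∣m) (*-monoʳ-∣ m j∣n)

  pos-division : ∀ x m .{{_ : NonZero m}} → + x ≡ + (x % m) + + (x / m) * + m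
  pos-division x m = begin
    + x                               ≡⟨ cong +_ (m≡m%n+[m/n]*n x m) ⟩
    + (x % m ℕ.+ x / m ℕ.* m)         ≡⟨ pos-+ (x % m) _ ⟩
    + (x % m) + + (x / m ℕ.* m)       ≡⟨ cong (λ z → + (x % m) + z) (pos-* (x / m) m) ⟩
    + (x % m) + + (x / m) * + m       ∎

  %≡%⇒∣- : ∀ m .{{_ : NonZero m}} {x y} → x % m ≡ y % m → + m ∣ + x - + y
  %≡%⇒∣- m {x} {y} x≡y = divides (+ (x / m) - + (y / m)) (begin
    + x - + y
      ≡⟨ cong₂ _-_ (pos-division x m) (pos-division y m) ⟩
    (+ (x % m) + + (x / m) * + m) - (+ (y % m) + + (y / m) * + m)
      ≡⟨ cong (λ r → (+ r + + (x / m) * + m) - (+ (y % m) + + (y / m) * + m)) x≡y ⟩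
    (+ (y % m) + + (x / m) * + m) - (+ (y % m) + + (y / m) * + m)
      ≡⟨ cancel (+ (y % m)) (+ (x / m)) (+ (y / m)) (+ m) ⟩
    (+ (x / m) - + (y / m)) * + m ∎)
    where
    cancel : ∀ r a b c → (r + a * c) - (r + b * c) ≡ (a - b) * c
    cancel = solve-∀

  ∣-⇒%≡% : ∀ m .{{_ : NonZero m}} {x y} → + m ∣ + x - + y → x % m ≡ y % m
  ∣-⇒%≡% m {x} {y} m∣x-y = from-∣⊖∣ (subst (λ z → m ℕ.∣ ∣ z ∣) (m-n≡m⊖n x y) (∣⇒∣ᵤ m∣x-y))
    where
    remove-difference : ∀ {u v} → u ℕ.≤ v → m ℕ.∣ v ℕ.∸ u → v % m ≡ u % m
    remove-difference {u} u≤v m∣v-u = trans (cong (_% m) (sym (m+[n∸m]≡n u≤v))) (%-remove-+ʳ u m∣v-u)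
    from-∣⊖∣ : m ℕ.∣ ∣ x ⊖ y ∣ → x % m ≡ y % m
    from-∣⊖∣ m∣ with ≤-total x y
    ... | inj₁ x≤y = sym (remove-difference x≤y (subst (m ℕ.∣_) (∣⊖∣-≤ x≤y) m∣))
    ... | inj₂ y≤x = remove-difference y≤x (subst (m ℕ.∣_) (trans (∣m⊖n∣≡∣n⊖m∣ x y) (∣⊖∣-≤ y≤x)) m∣)

  pos-sum₃ : ∀ a b c → + (a ℕ.+ b ℕ.+ c) ≡ + a + + b + + c
  pos-sum₃ a b c = trans (pos-+ (a ℕ.+ b) c) (cong (_+ + c) (pos-+ a b))

  pos-linear : ∀ x₁ x₂ x₃ x₄ x₅ x₆ → x₁ ℕ.+ x₂ ℕ.+ x₃ ≡ x₄ ℕ.+ x₅ ℕ.+ x₆ →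
               + x₁ + + x₂ + + x₃ ≡ + x₄ + + x₅ + + x₆
  pos-linear x₁ x₂ x₃ x₄ x₅ x₆ eq =
    trans (sym (pos-sum₃ x₁ x₂ x₃)) (trans (cong +_ eq) (pos-sum₃ x₄ x₅ x₆))

  pos-quadratic : ∀ x₁ x₂ x₃ x₄ x₅ x₆ →
                  x₁ ℕ.* x₁ ℕ.+ x₂ ℕ.* x₂ ℕ.+ x₃ ℕ.* x₃ ≡ x₄ ℕ.* x₄ ℕ.+ x₅ ℕ.* x₅ ℕ.+ x₆ ℕ.* x₆ →
                  + x₁ * + x₁ + + x₂ * + x₂ + + x₃ * + x₃ ≡ + x₄ * + x₄ + + x₅ * + x₅ + + x₆ * + x₆
  pos-quadratic x₁ x₂ x₃ x₄ x₅ x₆ eq =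
    trans (sym (pos-squares₃ x₁ x₂ x₃)) (trans (cong +_ eq) (pos-squares₃ x₄ x₅ x₆))
    where
    pos-squares₃ : ∀ a b c → + (a ℕ.* a ℕ.+ b ℕ.* b ℕ.+ c ℕ.* c) ≡ + a * + a + + b * + b + + c * + c
    pos-squares₃ a b c = trans (pos-sum₃ (a ℕ.* a) (b ℕ.* b) (c ℕ.* c))
      (cong₂ _+_ (cong₂ _+_ (pos-* a a) (pos-* b b)) (pos-* c c))

  ∣cofactor⇒∣2[ξ-η] : ∀ {d x₁ x₂ x₄ ξ η} → d ∣ x₁ - ξ → d ∣ x₄ - ξ → d ∣ x₂ - η →
                      d ∣ x₁ + x₄ - + 2 * x₂ → d ∣ + 2 * (ξ - η)
  ∣cofactor⇒∣2[ξ-η] {x₁ = x₁} {x₂} {x₄} {ξ} {η} d∣x₁-ξ d∣x₄-ξ d∣x₂-η d∣w =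
    subst (_ ∣_) (regroup x₁ x₂ x₄ ξ η)
      (∣m∣n⇒∣m-n d∣w (∣m∣n⇒∣m-n (∣m∣n⇒∣m+n d∣x₁-ξ d∣x₄-ξ) (∣n⇒∣m*n (+ 2) d∣x₂-η)))
    where
    regroup : ∀ x₁ x₂ x₄ ξ η →
              (x₁ + x₄ - + 2 * x₂) - ((x₁ - ξ) + (x₄ - ξ) - + 2 * (x₂ - η)) ≡ + 2 * (ξ - η)
    regroup = solve-∀

  odd-prime∤cofactor : ∀ {p} x₁ x₂ x₄ ξ η → Prime p → 3 ℕ.≤ p →
                       + p ∣ x₁ - ξ → + p ∣ x₄ - ξ → + p ∣ x₂ - η → ¬ + p ∣ ξ - η →
                       ¬ + p ∣ x₁ + x₄ - + 2 * x₂
  odd-prime∤cofactor {p} x₁ x₂ x₄ ξ η p-prime 3≤p p∣x₁-ξ p∣x₄-ξ p∣x₂-η p∤ξ-η p∣w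
    with euclidsLemma 2 ∣ ξ - η ∣ p-prime
           (subst (p ℕ.∣_) (abs-* (+ 2) (ξ - η))
             (∣⇒∣ᵤ (∣cofactor⇒∣2[ξ-η] {x₁ = x₁} {x₂} {x₄} {ξ} {η} p∣x₁-ξ p∣x₄-ξ p∣x₂-η p∣w)))
  ... | inj₁ p∣2     = <⇒≱ (s≤s (s≤s (s≤s z≤n))) (≤-trans 3≤p (ℕ.∣⇒≤ p∣2))
  ... | inj₂ p∣∣ξ-η∣ = p∤ξ-η (∣ᵤ⇒∣ p∣∣ξ-η∣)

  module SolutionDifferences (x₁ x₂ x₃ x₄ x₅ x₆ : ℤ)
           (linear : x₁ + x₂ + x₃ ≡ x₄ + x₅ + x₆)
           (quadratic : x₁ * x₁ + x₂ * x₂ + x₃ * x₃ ≡ x₄ * x₄ + x₅ * x₅ + x₆ * x₆) where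

    difference-factorisation :
      (x₁ - x₄) * (x₁ + x₄ - + 2 * x₂) ≡ (x₅ - x₂) * (x₅ - x₂) + (x₆ - x₃) * (x₆ - x₃ + + 2 * (x₃ - x₂))
    difference-factorisation = begin
      (x₁ - x₄) * (x₁ + x₄ - + 2 * x₂)
        ≡⟨ expand x₁ x₂ x₃ x₄ x₅ x₆ ⟩
      R + (Q₁ - Q₂) - + 2 * x₂ * (L₁ - L₂)
        ≡⟨ cong₂ (λ q l → R + q - + 2 * x₂ * l) (i≡j⇒i-j≡0 quadratic) (i≡j⇒i-j≡0 linear) ⟩
      R + 0ℤ - + 2 * x₂ * 0ℤ
        ≡⟨ vanish R (+ 2 * x₂) ⟩
      R ∎
      where
      R = (x₅ - x₂) * (x₅ - x₂) + (x₆ - x₃) * (x₆ - x₃ + + 2 * (x₃ - x₂))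
      L₁ = x₁ + x₂ + x₃
      L₂ = x₄ + x₅ + x₆
      Q₁ = x₁ * x₁ + x₂ * x₂ + x₃ * x₃
      Q₂ = x₄ * x₄ + x₅ * x₅ + x₆ * x₆
      expand : ∀ x₁ x₂ x₃ x₄ x₅ x₆ → (x₁ - x₄) * (x₁ + x₄ - + 2 * x₂) ≡
        (x₅ - x₂) * (x₅ - x₂) + (x₆ - x₃) * (x₆ - x₃ + + 2 * (x₃ - x₂))
          + ((x₁ * x₁ + x₂ * x₂ + x₃ * x₃) - (x₄ * x₄ + x₅ * x₅ + x₆ * x₆))
          - + 2 * x₂ * ((x₁ + x₂ + x₃) - (x₄ + x₅ + x₆))
      expand = solve-∀
      vanish : ∀ r c → r + 0ℤ - c * 0ℤ ≡ r
      vanish = solve-∀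

    square∣difference-product : ∀ {d} → d ∣ x₅ - x₂ → d ∣ x₆ - x₃ → d ∣ x₃ - x₂ →
                                d * d ∣ (x₁ - x₄) * (x₁ + x₄ - + 2 * x₂)
    square∣difference-product d∣s d∣t d∣c = subst (_ ∣_) (sym difference-factorisation)
      (∣m∣n⇒∣m+n (*-pres-∣ d∣s d∣s) (*-pres-∣ d∣t (∣m∣n⇒∣m+n d∣t (∣n⇒∣m*n (+ 2) d∣c))))

    p²ᵇ∣x₁-x₄ : ∀ {p} b → Prime p → ¬ + p ∣ x₁ + x₄ - + 2 * x₂ →
                + (p ℕ.^ b) ∣ x₅ - x₂ → + (p ℕ.^ b) ∣ x₆ - x₃ → + (p ℕ.^ b) ∣ x₃ - x₂ →
                + (p ℕ.^ (2 ℕ.* b)) ∣ x₁ - x₄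
    p²ᵇ∣x₁-x₄ {p} b p-prime p∤w pᵇ∣s pᵇ∣t pᵇ∣c = ∣ᵤ⇒∣ (p^k∣m*n⇒p^k∣m p-prime (p∤w ∘ ∣ᵤ⇒∣) (2 ℕ.* b)
      (subst₂ ℕ._∣_ (trans (abs-* (+ (p ℕ.^ b)) (+ (p ℕ.^ b))) p^b*p^b≡p^[2b])
                    (abs-* (x₁ - x₄) (x₁ + x₄ - + 2 * x₂))
        (∣⇒∣ᵤ (square∣difference-product pᵇ∣s pᵇ∣t pᵇ∣c))))
      where
      p^b*p^b≡p^[2b] : p ℕ.^ b ℕ.* p ℕ.^ b ≡ p ℕ.^ (2 ℕ.* b)
      p^b*p^b≡p^[2b] =
        trans (sym (^-distribˡ-+-* p b b)) (cong (λ e → p ℕ.^ (b ℕ.+ e)) (sym (+-identityʳ b)))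

open import Defs
open import Data.Bool using (Bool; true; false; T; _∧_; if_then_else_)
open import Data.Bool.Properties using (T-∧)
import Data.Integer.Base as ℤ
import Data.Integer.Divisibility.Signed as ℤ
open import Data.List using (List; []; _∷_; map; upTo; length)
open import Data.List.Properties using (length-upTo; map-cong)
open import Data.List.Membership.Propositional using (_∈_)
open import Data.List.Membership.Propositional.Properties using (∈-upTo⁺; ∈-upTo⁻; ∈-concatMap⁺)
open import Data.List.Relation.Unary.All using (All; []; _∷_)
import Data.List.Relation.Unary.All.Properties as All
open import Data.List.Relation.Unary.Any using (here; there)
import Data.List.Relation.Unary.Any as Any
open import Data.Nat
open import Data.Nat.Properties
open import Algebra.Properties.CommutativeSemigroup +-commutativeSemigroup using (interchange)
open import Data.Nat.DivMod
  using (_%_; _/_; m≡m%n+[m/n]*n; m%n<n; m%n%n≡m%n; m<n⇒m%n≡m; m∣n⇒o%n%m≡o%m; m<n*o⇒m/o<n; %-remove-+ʳ)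
open import Data.Nat.Divisibility using (_∣_; divides; ∣-trans; m∣m*n; n∣m*n)
open import Data.Nat.ListAction using (sum)
open import Data.Nat.Primality using (Prime; prime⇒nonZero)
open import Data.Product using (_×_; _,_; ∃-syntax)
open import Data.Unit using (tt)
open import Function using (_∘_; id; _⇔_; mk⇔; Equivalence)
open import Relation.Nullary using (¬_; contradiction)
open import Relation.Binary.PropositionalEquality
open IntegerCongruences

≡mod⇒≡% : ∀ m .{{_ : NonZero m}} {x y} → x mod m ≡ y mod m → x % m ≡ y % m
≡mod⇒≡% (suc m) eq = eq

≡%⇒≡mod : ∀ m .{{_ : NonZero m}} {x y} → x % m ≡ y % m → x mod m ≡ y mod m
≡%⇒≡mod (suc m) eq = eq

T-cong? : ∀ m .{{_ : NonZero m}} {x y} → T (cong? m x y) ⇔ (x % m ≡ y % m)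
T-cong? (suc m) {x} {y} = mk⇔ (≡ᵇ⇒≡ (x % suc m) (y % suc m)) (≡⇒≡ᵇ (x % suc m) (y % suc m))

+k*m<K*m : ∀ {ξ m k K} → ξ < m → k < K → ξ + k * m < K * m
+k*m<K*m {m = m} {k} ξ<m k<K = ≤-trans (+-monoˡ-< (k * m) ξ<m) (*-monoˡ-≤ m k<K)

p^[2b]≡p^[2b-a]*p^a : ∀ p b {a} → a ≤ 2 * b → p ^ (2 * b) ≡ p ^ (2 * b ∸ a) * p ^ a
p^[2b]≡p^[2b-a]*p^a p b {a} a≤2b =
  trans (cong (p ^_) (sym (m∸n+n≡m a≤2b))) (^-distribˡ-+-* p (2 * b ∸ a) a)

m∣m^n : ∀ m {n} → 1 ≤ n → m ∣ m ^ n
m∣m^n m {suc n} _ = m∣m*n (m ^ n)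

%-refine : ∀ {m K n} .{{_ : NonZero m}} .{{_ : NonZero n}} → n ≡ K * m →
           ∀ {ξ} x → ξ < m → x % m ≡ ξ % m → ∃[ k ] k < K × x % n ≡ (ξ + k * m) % n
%-refine {m} {K} {n} n≡K*m {ξ} x ξ<m x≡ξ = r / m , r/m<K , x%n≡ξ+km%n
  where
  r : ℕ
  r = x % n
  r%m≡ξ : r % m ≡ ξ
  r%m≡ξ = trans (m∣n⇒o%n%m≡o%m m n x (divides K n≡K*m)) (trans x≡ξ (m<n⇒m%n≡m ξ<m))
  r/m<K : r / m < K
  r/m<K = m<n*o⇒m/o<n (subst (r <_) n≡K*m (m%n<n x n))
  x%n≡ξ+km%n : x % n ≡ (ξ + r / m * m) % n
  x%n≡ξ+km%n = trans (sym (m%n%n≡m%n x n))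
    (cong (_% n) (trans (m≡m%n+[m/n]*n r m) (cong (_+ r / m * m) r%m≡ξ)))

module _ {A : Set} where

  sum-map-mono : ∀ (L : List A) {f g : A → ℕ} → (∀ {x} → x ∈ L → f x ≤ g x) →
                 sum (map f L) ≤ sum (map g L)
  sum-map-mono []      f≤g = z≤n
  sum-map-mono (x ∷ L) f≤g = +-mono-≤ (f≤g (here refl)) (sum-map-mono L (f≤g ∘ there))

  sum-map-const : ∀ (L : List A) c → sum (map (λ _ → c) L) ≡ length L * c
  sum-map-const []      c = refl
  sum-map-const (x ∷ L) c = cong (c +_) (sum-map-const L c)

  sum-map-+ : ∀ (L : List A) (f g : A → ℕ) →
              sum (map (λ x → f x + g x) L) ≡ sum (map f L) + sum (map g L)
  sum-map-+ []      f g = refl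
  sum-map-+ (x ∷ L) f g = trans (cong (f x + g x +_) (sum-map-+ L f g))
    (interchange (f x) (g x) (sum (map f L)) (sum (map g L)))

  ∈⇒≤sum-map : ∀ {L : List A} (f : A → ℕ) {x} → x ∈ L → f x ≤ sum (map f L)
  ∈⇒≤sum-map {y ∷ L} f (here refl) = m≤m+n (f y) _
  ∈⇒≤sum-map {y ∷ L} f (there x∈L) = ≤-trans (∈⇒≤sum-map f x∈L) (m≤n+m _ (f y))

  sum-map-bounded : ∀ (L : List A) {f : A → ℕ} {c} → (∀ {x} → x ∈ L → f x ≤ c) →
                    sum (map f L) ≤ length L * c
  sum-map-bounded L {c = c} f≤c = ≤-trans (sum-map-mono L f≤c) (≤-reflexive (sum-map-const L c))

sum-map-swap : ∀ {A B : Set} (L : List A) (M : List B) (h : B → A → ℕ) →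
               sum (map (λ x → sum (map (λ k → h k x) M)) L) ≡ sum (map (λ k → sum (map (h k) L)) M)
sum-map-swap []      M h = sym (trans (sum-map-const M 0) (*-zeroʳ (length M)))
sum-map-swap (x ∷ L) M h = trans (cong (sum (map (λ k → h k x) M) +_) (sum-map-swap L M h))
  (sym (sum-map-+ M (λ k → h k x) (λ k → sum (map (h k) L))))

Fun : ℕ → Set
Fun zero    = ℕ
Fun (suc n) = ℕ → Fun n

Σⁿ : ∀ n → ℕ → Fun n → ℕ
Σⁿ zero    X f = f
Σⁿ (suc n) X f = Σ≤ X (λ x → Σⁿ n X (f x))

Pointwise-≤ : ∀ n → Fun n → Fun n → Set
Pointwise-≤ zero    f g = f ≤ g
Pointwise-≤ (suc n) f g = ∀ x → Pointwise-≤ n (f x) (g x)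

pointwise-sum : ∀ n → List ℕ → (ℕ → Fun n) → Fun n
pointwise-sum zero    L h = sum (map h L)
pointwise-sum (suc n) L h = λ x → pointwise-sum n L (λ k → h k x)

Σⁿ-mono : ∀ n X {f g} → Pointwise-≤ n f g → Σⁿ n X f ≤ Σⁿ n X g
Σⁿ-mono zero    X f≤g = f≤g
Σⁿ-mono (suc n) X f≤g = sum-map-mono (range X) (λ {x} _ → Σⁿ-mono n X (f≤g x))

Σⁿ-pointwise-sum : ∀ n X L (h : ℕ → Fun n) →
                   Σⁿ n X (pointwise-sum n L h) ≡ sum (map (λ k → Σⁿ n X (h k)) L)
Σⁿ-pointwise-sum zero    X L h = refl
Σⁿ-pointwise-sum (suc n) X L h = trans
  (cong sum (map-cong (λ x → Σⁿ-pointwise-sum n X L (λ k → h k x)) (range X)))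
  (sum-map-swap (range X) L (λ k x → Σⁿ n X (h k x)))

maxList-lub : ∀ {c} (L : List ℕ) → All (_≤ c) L → maxList L ≤ c
maxList-lub []      []           = z≤n
maxList-lub (x ∷ L) (x≤c ∷ L≤c) = ⊔-lub x≤c (maxList-lub L L≤c)

∈⇒≤maxList : ∀ {L : List ℕ} {x} → x ∈ L → x ≤ maxList L
∈⇒≤maxList {y ∷ L} (here refl) = m≤m⊔n y (maxList L)
∈⇒≤maxList {y ∷ L} (there x∈L) = ≤-trans (∈⇒≤maxList x∈L) (m≤n⊔m y (maxList L))

module _ (X p a b : ℕ) where

  I₁-lub : ∀ {c} → (∀ {ξ η} → ξ < p ^ a → η < p ^ b → ¬ T (cong? p ξ η) → I₁at X p ξ η a b ≤ c) →
           I₁ X p a b ≤ c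
  I₁-lub {c} bound = maxList-lub _ (All.concat⁺ (All.map⁺ (All.applyUpTo⁺₁ id (p ^ a) λ ξ<pᵃ →
    All.concat⁺ (All.map⁺ (All.applyUpTo⁺₁ id (p ^ b) λ η<pᵇ → admissible ξ<pᵃ η<pᵇ)))))
    where
    admissible : ∀ {ξ η} → ξ < p ^ a → η < p ^ b →
                 All (_≤ c) (if cong? p ξ η then [] else (I₁at X p ξ η a b ∷ []))
    admissible {ξ} {η} ξ<pᵃ η<pᵇ with cong? p ξ η in ξ≡η
    ... | true  = []
    ... | false = bound ξ<pᵃ η<pᵇ (subst T ξ≡η) ∷ []

  I₁at≤I₁ : ∀ {ξ η} → ξ < p ^ a → η < p ^ b → ¬ T (cong? p ξ η) → I₁at X p ξ η a b ≤ I₁ X p a b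
  I₁at≤I₁ {ξ} {η} ξ<pᵃ η<pᵇ ξ≢η = ∈⇒≤maxList (∈-concatMap⁺ _ (Any.map (λ { refl →
    ∈-concatMap⁺ _ (Any.map (λ { refl → admissible }) (∈-upTo⁺ η<pᵇ)) }) (∈-upTo⁺ ξ<pᵃ)))
    where
    admissible : I₁at X p ξ η a b ∈ (if cong? p ξ η then [] else (I₁at X p ξ η a b ∷ []))
    admissible with cong? p ξ η
    ... | true  = contradiction tt ξ≢η
    ... | false = here refl

𝟙≤sum-map-𝟙 : ∀ {A : Set} {b} (L : List A) (c : A → Bool) →
              (T b → ∃[ k ] k ∈ L × T (c k)) → 𝟙 b ≤ sum (map (𝟙 ∘ c) L)
𝟙≤sum-map-𝟙 {b = false} L c witness = z≤n
𝟙≤sum-map-𝟙 {b = true}  L c witness with witness tt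
... | k , k∈L , c[k] = ≤-trans (T⇒1≤𝟙 c[k]) (∈⇒≤sum-map (𝟙 ∘ c) k∈L)
  where
  T⇒1≤𝟙 : ∀ {b} → T b → 1 ≤ 𝟙 b
  T⇒1≤𝟙 {true} _ = ≤-refl

-- The summand of I₁at verbatim, so that I₁at X p ξ η a b unfolds to
-- Σⁿ 6 X (λ x₁ x₂ x₃ x₄ x₅ x₆ → 𝟙 (isSolution p ξ η a b x₁ x₂ x₃ x₄ x₅ x₆)).
isSolution : (p ξ η a b x₁ x₂ x₃ x₄ x₅ x₆ : ℕ) → Bool
isSolution p ξ η a b x₁ x₂ x₃ x₄ x₅ x₆ =
    ((x₁ + x₂ + x₃) ≡ᵇ (x₄ + x₅ + x₆))
  ∧ ((x₁ * x₁ + x₂ * x₂ + x₃ * x₃) ≡ᵇ (x₄ * x₄ + x₅ * x₅ + x₆ * x₆))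
  ∧ cong? (p ^ a) x₁ ξ ∧ cong? (p ^ a) x₄ ξ
  ∧ cong? (p ^ b) x₂ η ∧ cong? (p ^ b) x₃ η
  ∧ cong? (p ^ b) x₅ η ∧ cong? (p ^ b) x₆ η

record Solution (p ξ η a b x₁ x₂ x₃ x₄ x₅ x₆ : ℕ) : Set where
  field
    linear    : x₁ + x₂ + x₃ ≡ x₄ + x₅ + x₆
    quadratic : x₁ * x₁ + x₂ * x₂ + x₃ * x₃ ≡ x₄ * x₄ + x₅ * x₅ + x₆ * x₆
    x₁≡ξ : x₁ mod (p ^ a) ≡ ξ mod (p ^ a)
    x₄≡ξ : x₄ mod (p ^ a) ≡ ξ mod (p ^ a)
    x₂≡η : x₂ mod (p ^ b) ≡ η mod (p ^ b)
    x₃≡η : x₃ mod (p ^ b) ≡ η mod (p ^ b)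
    x₅≡η : x₅ mod (p ^ b) ≡ η mod (p ^ b)
    x₆≡η : x₆ mod (p ^ b) ≡ η mod (p ^ b)

T-isSolution : ∀ p ξ η a b x₁ x₂ x₃ x₄ x₅ x₆ →
               T (isSolution p ξ η a b x₁ x₂ x₃ x₄ x₅ x₆) ⇔ Solution p ξ η a b x₁ x₂ x₃ x₄ x₅ x₆
T-isSolution p ξ η a b x₁ x₂ x₃ x₄ x₅ x₆ = mk⇔ decode encode
  where
  decode : T (isSolution p ξ η a b x₁ x₂ x₃ x₄ x₅ x₆) → Solution p ξ η a b x₁ x₂ x₃ x₄ x₅ x₆
  decode t =
    let l , t = Equivalence.to T-∧ t
        q , t = Equivalence.to T-∧ t
        c₁ , t = Equivalence.to T-∧ t
        c₄ , t = Equivalence.to T-∧ t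
        c₂ , t = Equivalence.to T-∧ t
        c₃ , t = Equivalence.to T-∧ t
        c₅ , c₆ = Equivalence.to T-∧ t
    in record
      { linear = ≡ᵇ⇒≡ _ _ l ; quadratic = ≡ᵇ⇒≡ _ _ q
      ; x₁≡ξ = ≡ᵇ⇒≡ _ _ c₁ ; x₄≡ξ = ≡ᵇ⇒≡ _ _ c₄
      ; x₂≡η = ≡ᵇ⇒≡ _ _ c₂ ; x₃≡η = ≡ᵇ⇒≡ _ _ c₃
      ; x₅≡η = ≡ᵇ⇒≡ _ _ c₅ ; x₆≡η = ≡ᵇ⇒≡ _ _ c₆
      }
  infixr 6 _∧ᵀ_
  _∧ᵀ_ : ∀ {u v} → T u → T v → T (u ∧ v)
  u ∧ᵀ v = Equivalence.from T-∧ (u , v)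
  t : ∀ {m n} → m ≡ n → T (m ≡ᵇ n)
  t {m} {n} = ≡⇒≡ᵇ m n
  encode : Solution p ξ η a b x₁ x₂ x₃ x₄ x₅ x₆ → T (isSolution p ξ η a b x₁ x₂ x₃ x₄ x₅ x₆)
  encode s = t linear ∧ᵀ t quadratic ∧ᵀ t x₁≡ξ ∧ᵀ t x₄≡ξ ∧ᵀ t x₂≡η ∧ᵀ t x₃≡η ∧ᵀ t x₅≡η ∧ᵀ t x₆≡η
    where open Solution s

module Lifting {p : ℕ} (p-prime : Prime p) (3≤p : 3 ≤ p) {a b : ℕ} (1≤a : 1 ≤ a) (1≤b : 1 ≤ b) where
  private instance
    p≢0 : NonZero p
    p≢0 = prime⇒nonZero p-prime
    pᵃ≢0 : NonZero (p ^ a)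
    pᵃ≢0 = m^n≢0 p a
    pᵇ≢0 : NonZero (p ^ b)
    pᵇ≢0 = m^n≢0 p b
    p²ᵇ≢0 : NonZero (p ^ (2 * b))
    p²ᵇ≢0 = m^n≢0 p (2 * b)

  Solution⇒x₁≡x₄ : ∀ {ξ η x₁ x₂ x₃ x₄ x₅ x₆} → ξ % p ≢ η % p → Solution p ξ η a b x₁ x₂ x₃ x₄ x₅ x₆ →
                   x₁ % p ^ (2 * b) ≡ x₄ % p ^ (2 * b)
  Solution⇒x₁≡x₄ {ξ} {η} {x₁} {x₂} {x₃} {x₄} {x₅} {x₆} ξ≢η s = ∣-⇒%≡% (p ^ (2 * b))
    (p²ᵇ∣x₁-x₄ b p-prime
      (odd-prime∤cofactor (ℤ.+ x₁) (ℤ.+ x₂) (ℤ.+ x₄) (ℤ.+ ξ) (ℤ.+ η) p-prime 3≤p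
        (p∣ 1≤a x₁≡ξ) (p∣ 1≤a x₄≡ξ) (p∣ 1≤b x₂≡η) (ξ≢η ∘ ∣-⇒%≡% p))
      (pᵇ∣ (trans x₅≡η (sym x₂≡η))) (pᵇ∣ (trans x₆≡η (sym x₃≡η))) (pᵇ∣ (trans x₃≡η (sym x₂≡η))))
    where
    open Solution s
    open SolutionDifferences (ℤ.+ x₁) (ℤ.+ x₂) (ℤ.+ x₃) (ℤ.+ x₄) (ℤ.+ x₅) (ℤ.+ x₆)
      (pos-linear x₁ x₂ x₃ x₄ x₅ x₆ linear) (pos-quadratic x₁ x₂ x₃ x₄ x₅ x₆ quadratic)
    pᵇ∣ : ∀ {u v} → u mod (p ^ b) ≡ v mod (p ^ b) → ℤ.+ (p ^ b) ℤ.∣ ℤ.+ u ℤ.- ℤ.+ v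
    pᵇ∣ u≡v = %≡%⇒∣- (p ^ b) (≡mod⇒≡% (p ^ b) u≡v)
    p∣ : ∀ {c u v} → 1 ≤ c → u mod (p ^ c) ≡ v mod (p ^ c) → ℤ.+ p ℤ.∣ ℤ.+ u ℤ.- ℤ.+ v
    p∣ {c} 1≤c u≡v = ℤ.∣-trans (ℤ.∣ᵤ⇒∣ (m∣m^n p 1≤c))
      (%≡%⇒∣- (p ^ c) {{m^n≢0 p c}} (≡mod⇒≡% (p ^ c) {{m^n≢0 p c}} u≡v))

  lift-Solution : a ≤ 2 * b → ∀ {ξ η x₁ x₂ x₃ x₄ x₅ x₆} → ξ < p ^ a → ξ % p ≢ η % p →
                  Solution p ξ η a b x₁ x₂ x₃ x₄ x₅ x₆ →
                  ∃[ k ] k < p ^ (2 * b ∸ a) × Solution p (ξ + k * p ^ a) η (2 * b) b x₁ x₂ x₃ x₄ x₅ x₆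
  lift-Solution a≤2b {x₁ = x₁} ξ<pᵃ ξ≢η s =
    let k , k<K , x₁≡ξ′ = %-refine (p^[2b]≡p^[2b-a]*p^a p b a≤2b) x₁ ξ<pᵃ (≡mod⇒≡% (p ^ a) x₁≡ξ)
    in k , k<K , record
      { linear = linear ; quadratic = quadratic
      ; x₁≡ξ = ≡%⇒≡mod (p ^ (2 * b)) x₁≡ξ′
      ; x₄≡ξ = ≡%⇒≡mod (p ^ (2 * b)) (trans (sym (Solution⇒x₁≡x₄ ξ≢η s)) x₁≡ξ′)
      ; x₂≡η = x₂≡η ; x₃≡η = x₃≡η ; x₅≡η = x₅≡η ; x₆≡η = x₆≡η
      }
    where open Solution s

  I₁at≤sum-lifts : a ≤ 2 * b → ∀ X {ξ η} → ξ < p ^ a → ¬ T (cong? p ξ η) →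
                   I₁at X p ξ η a b ≤
                   sum (map (λ k → I₁at X p (ξ + k * p ^ a) η (2 * b) b) (upTo (p ^ (2 * b ∸ a))))
  I₁at≤sum-lifts a≤2b X {ξ} {η} ξ<pᵃ ξ≢η =
    ≤-trans (Σⁿ-mono 6 X lifted) (≤-reflexive (Σⁿ-pointwise-sum 6 X (upTo (p ^ (2 * b ∸ a))) _))
    where
    lifted : Pointwise-≤ 6 (λ x₁ x₂ x₃ x₄ x₅ x₆ → 𝟙 (isSolution p ξ η a b x₁ x₂ x₃ x₄ x₅ x₆))
      (pointwise-sum 6 (upTo (p ^ (2 * b ∸ a)))
        (λ k x₁ x₂ x₃ x₄ x₅ x₆ → 𝟙 (isSolution p (ξ + k * p ^ a) η (2 * b) b x₁ x₂ x₃ x₄ x₅ x₆)))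
    lifted x₁ x₂ x₃ x₄ x₅ x₆ =
      𝟙≤sum-map-𝟙 _ (λ k → isSolution p (ξ + k * p ^ a) η (2 * b) b x₁ x₂ x₃ x₄ x₅ x₆) λ t →
        let k , k<K , s = lift-Solution a≤2b ξ<pᵃ (ξ≢η ∘ Equivalence.from (T-cong? p))
                            (Equivalence.to (T-isSolution p ξ η a b x₁ x₂ x₃ x₄ x₅ x₆) t)
        in k , ∈-upTo⁺ k<K , Equivalence.from (T-isSolution p _ η (2 * b) b x₁ x₂ x₃ x₄ x₅ x₆) s

  lift-I₁at≤I₁ : a ≤ 2 * b → ∀ X {ξ η k} → ξ < p ^ a → η < p ^ b → ¬ T (cong? p ξ η) →
                 k ∈ upTo (p ^ (2 * b ∸ a)) → I₁at X p (ξ + k * p ^ a) η (2 * b) b ≤ I₁ X p (2 * b) b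
  lift-I₁at≤I₁ a≤2b X {ξ} {η} {k} ξ<pᵃ η<pᵇ ξ≢η k∈upTo = I₁at≤I₁ X p (2 * b) b ξ′<p²ᵇ η<pᵇ ξ′≢η
    where
    ξ′<p²ᵇ : ξ + k * p ^ a < p ^ (2 * b)
    ξ′<p²ᵇ = subst (ξ + k * p ^ a <_) (sym (p^[2b]≡p^[2b-a]*p^a p b a≤2b))
               (+k*m<K*m ξ<pᵃ (∈-upTo⁻ k∈upTo))
    ξ′≡ξ : (ξ + k * p ^ a) % p ≡ ξ % p
    ξ′≡ξ = %-remove-+ʳ ξ (∣-trans (m∣m^n p 1≤a) (n∣m*n k))
    ξ′≢η : ¬ T (cong? p (ξ + k * p ^ a) η)
    ξ′≢η = ξ≢η ∘ Equivalence.from (T-cong? p) ∘ trans (sym ξ′≡ξ) ∘ Equivalence.to (T-cong? p)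

mainTheorem3 : (p : ℕ) → Prime p → 3 ≤ p → (X : ℕ) → 1 ≤ X → (a b : ℕ) → 1 ≤ a → 1 ≤ b → a ≤ 2 * b → I₁ X p a b ≤ p ^ (2 * b ∸ a) * I₁ X p (2 * b) b
mainTheorem3 p p-prime 3≤p X _ a b 1≤a 1≤b a≤2b = I₁-lub X p a b λ {ξ} {η} ξ<pᵃ η<pᵇ ξ≢η → begin
  I₁at X p ξ η a b
    ≤⟨ I₁at≤sum-lifts a≤2b X ξ<pᵃ ξ≢η ⟩
  sum (map (λ k → I₁at X p (ξ + k * p ^ a) η (2 * b) b) (upTo K))
    ≤⟨ sum-map-bounded (upTo K) (lift-I₁at≤I₁ a≤2b X ξ<pᵃ η<pᵇ ξ≢η) ⟩
  length (upTo K) * I₁ X p (2 * b) b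
    ≡⟨ cong (_* I₁ X p (2 * b) b) (length-upTo K) ⟩
  K * I₁ X p (2 * b) b ∎
  where
  open ≤-Reasoning
  open Lifting p-prime 3≤p 1≤a 1≤b
  K : ℕ
  K = p ^ (2 * b ∸ a)
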